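{- Let $G$ be a (simple, connected) treelike comparability graph which is a path of $k$ double-arborescences for some $k \ge 2$, where $k$ is the smallest integer such that $G$ is a path of $k$ double-arborescences. Then $G$ contains the path $P_4$ on four vertices as an induced subgraph.
   Context: All graphs are simple and connected. A graph $G=(V,E)$ is a comparability graph if it admits a transitive orientation (an orientation of the edges such that whenever $\overrightarrow{ab}$ and $\overrightarrow{bc}$ are arcs, $\overrightarrow{ac}$ is an arc). A transitive orientation induces a poset on $V$. $G$ is a treelike comparability graph if it admits a transitive orientation (a treelike orientation) whose Hasse diagram (the transitive reduction, obtained by deleting transitive arcs), viewed as an undirected graph, is a tree; such an orientation is unique up to isomorphism and reversing all arcs. A double-arborescence is a treelike comparability graph with an all-adjacent vertex $r$ (i.e. $V=\{r\}\cup N_G(r)$), called its root. A treelike comparability graph $G$ is a path of $k$ double-arborescences if (in its treelike orientation) $G$ consists precisely of $k$ double-arborescences (induced subgraphs) together with a path in the Hasse diagram connecting their roots. -}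

module Defs where

open import Data.Nat using (ℕ; zero; suc; _≤_; _<_)
open import Data.Fin using (Fin; toℕ; fromℕ; inject₁) renaming (zero to fzero; suc to fsuc)
open import Data.Product using (Σ; _×_; _,_; proj₁)
open import Data.Sum using (_⊎_)
open import Data.Bool using (Bool; T)
open import Relation.Nullary using (¬_)
open import Relation.Binary.PropositionalEquality using (_≡_; _≢_)

record Graph (V : Set) : Set₁ where
  field
    Adj    : V → V → Set
    sym    : ∀ {x y} → Adj x y → Adj y x
    irrefl : ∀ {x} → ¬ Adj x x
open Graph public

record Path {V : Set} (R : V → V → Set) (u v : V) : Set where
  field
    len   : ℕ
    vert  : Fin (suc len) → V
    inj   : ∀ i j → vert i ≡ vert j → i ≡ j
    start : vert fzero ≡ u
    end   : vert (fromℕ len) ≡ v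
    step  : ∀ (i : Fin len) → R (vert (inject₁ i)) (vert (fsuc i))

Connected : {V : Set} → (V → V → Set) → Set
Connected R = ∀ u v → Path R u v

record Cycle {V : Set} (R : V → V → Set) : Set where
  field
    len   : ℕ
    vert  : Fin (suc (suc (suc len))) → V
    inj   : ∀ i j → vert i ≡ vert j → i ≡ j
    step  : ∀ (i : Fin (suc (suc len))) → R (vert (inject₁ i)) (vert (fsuc i))
    close : R (vert (fromℕ (suc (suc len)))) (vert fzero)

IsTree : {V : Set} → (V → V → Set) → Set
IsTree R = Connected R × ¬ Cycle R

record IsTransitiveOrientation {V : Set} (G : Graph V) (_≺_ : V → V → Set) : Set where
  field
    edge→arc : ∀ {x y} → Adj G x y → (x ≺ y) ⊎ (y ≺ x)
    arc→edge : ∀ {x y} → x ≺ y → Adj G x y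
    asym     : ∀ {x y} → x ≺ y → ¬ (y ≺ x)
    trans    : ∀ {x y z} → x ≺ y → y ≺ z → x ≺ z

Cover : {V : Set} → (V → V → Set) → V → V → Set
Cover {V} _≺_ x y = (x ≺ y) × ¬ (Σ V λ z → (x ≺ z) × (z ≺ y))

HasseU : {V : Set} → (V → V → Set) → V → V → Set
HasseU R x y = Cover R x y ⊎ Cover R y x

TreelikeOrientation : {V : Set} → Graph V → (V → V → Set) → Set
TreelikeOrientation G _≺_ = IsTransitiveOrientation G _≺_ × IsTree (HasseU _≺_)

TreelikeComparability : {V : Set} → Graph V → Set₁
TreelikeComparability {V} G = Σ (V → V → Set) λ _≺_ → TreelikeOrientation G _≺_

Induced : {V : Set} → Graph V → (D : V → Bool) → Graph (Σ V λ v → T (D v))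
Induced G D = record
  { Adj = λ x y → Adj G (proj₁ x) (proj₁ y)
  ; sym = sym G
  ; irrefl = irrefl G }

DoubleArborescence : {V : Set} → Graph V → V → Set₁
DoubleArborescence G r = TreelikeComparability G × (∀ v → v ≢ r → Adj G r v)

record PathOfDAs {V : Set} (G : Graph V) (k : ℕ) : Set₁ where
  field
    _≺_      : V → V → Set
    treelike : TreelikeOrientation G _≺_
    D        : Fin k → V → Bool
    root     : Fin k → V
    rootIn   : ∀ i → T (D i (root i))
    da       : ∀ i → DoubleArborescence (Induced G (D i)) (root i , rootIn i)
    len      : ℕ
    path     : Fin (suc len) → V
    pathInj  : ∀ i j → path i ≡ path j → i ≡ j
    pathStep : ∀ (i : Fin len) → HasseU _≺_ (path (inject₁ i)) (path (fsuc i))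
    pos      : Fin k → Fin (suc len)
    posMono  : ∀ i j → toℕ i < toℕ j → toℕ (pos i) < toℕ (pos j)
    posRoot  : ∀ i → path (pos i) ≡ root i
    -- the path connects the roots: its ends are roots
    between  : ∀ (j : Fin (suc len)) → Σ (Fin k) λ i → Σ (Fin k) λ i' →
                 (toℕ (pos i) ≤ toℕ j) × (toℕ j ≤ toℕ (pos i'))
    covers   : ∀ v → (Σ (Fin k) λ i → T (D i v)) ⊎ (Σ (Fin (suc len)) λ j → path j ≡ v)

InducedP4 : {V : Set} → Graph V → Set
InducedP4 {V} G = Σ V λ a → Σ V λ b → Σ V λ c → Σ V λ d →
  Adj G a b × Adj G b c × Adj G c d ×
  ¬ Adj G a c × ¬ Adj G b d × ¬ Adj G a d

{-# OPTIONS --safe #-}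
-- If G had no induced P4, it would have a vertex adjacent to all others and would therefore be a
-- path of a single double-arborescence, contradicting the minimality of k ≥ 2.
-- In a poset whose Hasse diagram is a tree, two vertices are comparable exactly when the tree path
-- between them is monotone. Let r maximise its closed neighbourhood N[r] and follow the tree path
-- from r to any vertex w. When the path leaves a vertex u along a cover u ⋖ u₁ (upwards or
-- downwards), either the rest of it is monotone, so that w ∈ N[u], or it later turns at t and steps
-- to s; then any other cover z₁ of u in the same direction would give the induced P4 z₁ u t s, so
-- N[u] ⊆ N[u₁]. Maximality of |N[r]| turns these inclusions into equalities, hence w ∈ N[r].
module Submission where

open import Defs
open import Level using (0ℓ)
open import Data.Bool using (true; false; T)
open import Data.Empty using (⊥; ⊥-elim)
open import Data.Fin using (Fin; fromℕ; inject₁; _≟_) renaming (zero to fzero; suc to fsuc)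
open import Data.Fin.Induction using (spo-wellFounded; spo-noetherian)
open import Data.Fin.Properties using (any?; suc-injective)
open import Data.Fin.Subset using (Subset; _∈_; _⊆_; ∣_∣)
open import Data.Fin.Subset.Properties using (_∈?_; p⊆q⇒∣p∣≤∣q∣; p⊂q⇒∣p∣<∣q∣)
open import Data.List using (allFin)
import Data.List.Relation.Unary.All as ListAll
open import Data.List.Membership.Propositional.Properties using (∈-allFin)
open import Data.List.Extrema.Nat using (argmax; f[xs]≤f[argmax])
open import Data.Nat using (ℕ; zero; suc; _≤_; _<_; z≤n)
open import Data.Nat.Properties using (≤-trans; <-≤-trans; <-irrefl)
open import Data.Product using (Σ; Σ-syntax; _×_; _,_; proj₁; proj₂)
open import Data.Sum using (_⊎_; inj₁; inj₂; [_,_]; swap) renaming (map to ⊎-map)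
open import Data.Unit using (⊤; tt)
open import Data.Vec using (Vec; []; _∷_; lookup; tabulate)
open import Data.Vec.Properties using (lookup∘tabulate; lookup⇒[]=; []=⇒lookup)
open import Data.Vec.Relation.Unary.All using (All; []; _∷_)
open import Data.Vec.Relation.Unary.All.Properties using (lookup⁺)
open import Data.Vec.Relation.Unary.AllPairs using ([]; _∷_)
open import Data.Vec.Relation.Unary.Unique.Propositional using (Unique)
open import Data.Vec.Relation.Unary.Unique.Propositional.Properties using (lookup-injective)
open import Function using (id; _∘_; _on_; flip)
open import Induction.WellFounded using (Acc; acc; WellFounded)
open import Relation.Binary using (Rel)
open import Relation.Binary.Definitions using (Asymmetric; Transitive; Decidable)
open import Relation.Binary.Structures using (IsStrictPartialOrder)
open import Relation.Binary.Construct.Closure.ReflexiveTransitive using (Star; ε; _◅_; _◅◅_)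
open import Relation.Binary.Construct.Closure.ReflexiveTransitive.Properties using (◅◅-assoc)
open import Relation.Binary.PropositionalEquality
  using (_≡_; _≢_; refl; cong; subst; subst₂; isEquivalence) renaming (sym to ≡-sym; trans to ≡-trans)
open import Relation.Nullary using (¬_; Dec; yes; no; does)
open import Relation.Nullary.Decidable using (_×-dec_; _⊎-dec_; ¬?; map′; dec-true; dec-false; decidable-stable)
open import Relation.Unary using (Pred) renaming (Decidable to Decidable₁)

subset : ∀ {n} {P : Pred (Fin n) 0ℓ} → Decidable₁ P → Subset n
subset P? = tabulate (does ∘ P?)

module _ {n} {P : Pred (Fin n) 0ℓ} (P? : Decidable₁ P) where

  ∈-subset⁺ : ∀ {x} → P x → x ∈ subset P?
  ∈-subset⁺ {x} px = lookup⇒[]= x _ (≡-trans (lookup∘tabulate _ x) (dec-true (P? x) px))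

  ∈-subset⁻ : ∀ {x} → x ∈ subset P? → P x
  ∈-subset⁻ {x} x∈ = decidable-stable (P? x) λ ¬px →
    true≢false (≡-trans (≡-trans (≡-sym ([]=⇒lookup x∈)) (lookup∘tabulate _ x)) (dec-false (P? x) ¬px))
    where
    true≢false : true ≢ false
    true≢false ()

subset-mono : ∀ {n} {P Q : Pred (Fin n) 0ℓ} (P? : Decidable₁ P) (Q? : Decidable₁ Q) →
              (∀ {x} → P x → Q x) → subset P? ⊆ subset Q?
subset-mono P? Q? P⇒Q = ∈-subset⁺ Q? ∘ P⇒Q ∘ ∈-subset⁻ P?

p⊆q∧∣q∣≤∣p∣⇒q⊆p : ∀ {n} {p q : Subset n} → p ⊆ q → ∣ q ∣ ≤ ∣ p ∣ → q ⊆ p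
p⊆q∧∣q∣≤∣p∣⇒q⊆p {p = p} p⊆q ∣q∣≤∣p∣ {x} x∈q = decidable-stable (x ∈? p) λ x∉p →
  <-irrefl refl (<-≤-trans (p⊂q⇒∣p∣<∣q∣ (p⊆q , x , x∈q , x∉p)) ∣q∣≤∣p∣)

module _ {A B : Set} {R : Rel A 0ℓ} {S : Rel B 0ℓ} (f : A → B)
         (f-injective : ∀ {x y} → f x ≡ f y → x ≡ y) (f-hom : ∀ {x y} → R x y → S (f x) (f y)) where

  Path-map : ∀ {u v} → Path R u v → Path S (f u) (f v)
  Path-map P = record
    { len = len ; vert = f ∘ vert ; inj = λ i j → inj i j ∘ f-injective
    ; start = cong f start ; end = cong f end ; step = f-hom ∘ step }
    where open Path P

  Cycle-map : Cycle R → Cycle S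
  Cycle-map C = record
    { len = len ; vert = f ∘ vert ; inj = λ i j → inj i j ∘ f-injective
    ; step = f-hom ∘ step ; close = f-hom close }
    where open Cycle C

module _ {V : Set} {_≺_ : Rel V 0ℓ} where

  private
    V⁺ : Set
    V⁺ = Σ V λ v → T true

    Cover-on⁺ : ∀ {x y : V⁺} → Cover _≺_ (proj₁ x) (proj₁ y) → Cover (_≺_ on proj₁) x y
    Cover-on⁺ (x≺y , no-middle) = x≺y , λ (z , x≺z , z≺y) → no-middle (proj₁ z , x≺z , z≺y)

    Cover-on⁻ : ∀ {x y : V⁺} → Cover (_≺_ on proj₁) x y → Cover _≺_ (proj₁ x) (proj₁ y)
    Cover-on⁻ (x≺y , no-middle) = x≺y , λ (z , x≺z , z≺y) → no-middle ((z , tt) , x≺z , z≺y)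

  treelike-induced-everything : ∀ {G : Graph V} → TreelikeOrientation G _≺_ →
                                TreelikeOrientation (Induced G (λ _ → true)) (_≺_ on proj₁)
  treelike-induced-everything (orientation , connected , acyclic) =
    record { IsTransitiveOrientation orientation } ,
    (λ u v → Path-map (_, tt) (cong proj₁) (⊎-map Cover-on⁺ Cover-on⁺) (connected (proj₁ u) (proj₁ v))) ,
    (acyclic ∘ Cycle-map proj₁ (cong (_, tt)) (⊎-map Cover-on⁻ Cover-on⁻))

universal⇒PathOfDAs₁ : ∀ {n} {G : Graph (Fin n)} {_≺_ : Rel (Fin n) 0ℓ} → TreelikeOrientation G _≺_ →
                       (r : Fin n) → (∀ v → v ≢ r → Adj G r v) → PathOfDAs G 1
universal⇒PathOfDAs₁ {_≺_ = _≺_} treelike r universal = record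
  { _≺_      = _≺_
  ; treelike = treelike
  ; D        = λ _ _ → true
  ; root     = λ _ → r
  ; rootIn   = λ _ → tt
  ; da       = λ _ → (_ , treelike-induced-everything treelike) ,
                     λ v v≢r → universal (proj₁ v) (v≢r ∘ cong (_, tt))
  ; len      = 0
  ; path     = λ _ → r
  ; pathInj  = λ { fzero fzero _ → refl }
  ; pathStep = λ ()
  ; pos      = λ _ → fzero
  ; posMono  = λ { fzero fzero () }
  ; posRoot  = λ _ → refl
  ; between  = λ { fzero → fzero , fzero , z≤n , z≤n }
  ; covers   = λ _ → inj₁ (fzero , tt)
  }

data Dir : Set where
  up down : Dir

opp : Dir → Dir
opp up   = down
opp down = up

opp≢ : ∀ d → opp d ≢ d
opp≢ up   ()
opp≢ down ()

opp-involutive : ∀ d → opp (opp d) ≡ d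
opp-involutive up   = refl
opp-involutive down = refl

Dir-cases : ∀ d d′ → d′ ≡ d ⊎ d′ ≡ opp d
Dir-cases up   up   = inj₁ refl
Dir-cases up   down = inj₂ refl
Dir-cases down up   = inj₂ refl
Dir-cases down down = inj₁ refl

module HasseTree {n : ℕ} (_≺_ : Rel (Fin n) 0ℓ) (≺-asym : Asymmetric _≺_) (≺-trans : Transitive _≺_)
                 (hasse-tree : IsTree (HasseU _≺_)) where

  private
    variable
      x y z : Fin n

  ≺-irrefl : ¬ x ≺ x
  ≺-irrefl x≺x = ≺-asym x≺x x≺x

  ≺-isStrictPartialOrder : IsStrictPartialOrder _≡_ _≺_
  ≺-isStrictPartialOrder = record
    { isEquivalence = isEquivalence
    ; irrefl        = λ { refl → ≺-irrefl }
    ; trans         = ≺-trans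
    ; <-resp-≈      = (λ { refl p → p }) , (λ { refl p → p })
    }

  -- Indexing by a direction lets every argument be written once for ≺ and its dual.
  _<[_]_ : Fin n → Dir → Fin n → Set
  x <[ up ]   y = x ≺ y
  x <[ down ] y = y ≺ x

  _≤[_]_ : Fin n → Dir → Fin n → Set
  x ≤[ d ] y = x ≡ y ⊎ x <[ d ] y

  _⋖[_]_ : Fin n → Dir → Fin n → Set
  x ⋖[ up ]   y = Cover _≺_ x y
  x ⋖[ down ] y = Cover _≺_ y x

  <[]-irrefl : ∀ d → ¬ x <[ d ] x
  <[]-irrefl up   = ≺-irrefl
  <[]-irrefl down = ≺-irrefl

  <[]-asym : ∀ d → x <[ d ] y → ¬ y <[ d ] x
  <[]-asym up   = ≺-asym
  <[]-asym down = ≺-asym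

  <[]-trans : ∀ d → x <[ d ] y → y <[ d ] z → x <[ d ] z
  <[]-trans up   x<y y<z = ≺-trans x<y y<z
  <[]-trans down x<y y<z = ≺-trans y<z x<y

  <[]-≤[]-trans : ∀ d → x <[ d ] y → y ≤[ d ] z → x <[ d ] z
  <[]-≤[]-trans d x<y (inj₁ refl) = x<y
  <[]-≤[]-trans d x<y (inj₂ y<z)  = <[]-trans d x<y y<z

  <[opp]⇒> : ∀ d → x <[ opp d ] y → y <[ d ] x
  <[opp]⇒> up   x<y = x<y
  <[opp]⇒> down x<y = x<y

  >⇒<[opp] : ∀ d → y <[ d ] x → x <[ opp d ] y
  >⇒<[opp] up   y<x = y<x
  >⇒<[opp] down y<x = y<x

  <[]-wellFounded : ∀ d → WellFounded _<[ d ]_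
  <[]-wellFounded up   = spo-wellFounded ≺-isStrictPartialOrder
  <[]-wellFounded down = spo-noetherian ≺-isStrictPartialOrder

  >[]-wellFounded : ∀ d → WellFounded (flip _<[ d ]_)
  >[]-wellFounded up   = spo-noetherian ≺-isStrictPartialOrder
  >[]-wellFounded down = spo-wellFounded ≺-isStrictPartialOrder

  ⋖⇒< : ∀ d → x ⋖[ d ] y → x <[ d ] y
  ⋖⇒< up   = proj₁
  ⋖⇒< down = proj₁

  ⋖-opp : ∀ d → x ⋖[ d ] y → y ⋖[ opp d ] x
  ⋖-opp up   c = c
  ⋖-opp down c = c

  <∧¬between⇒⋖ : ∀ d → x <[ d ] y → ¬ (Σ[ z ∈ Fin n ] x <[ d ] z × z <[ d ] y) → x ⋖[ d ] y
  <∧¬between⇒⋖ up   x<y no-middle = x<y , no-middle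
  <∧¬between⇒⋖ down x<y no-middle = x<y , λ (z , y≺z , z≺x) → no-middle (z , z≺x , y≺z)

  -- Only doubly negated: decidability of ≺ is derived later, from the tree.
  cover-towards : ∀ d → x <[ d ] y → ¬ ¬ (Σ[ w ∈ Fin n ] x ⋖[ d ] w × w ≤[ d ] y)
  cover-towards {x} {y} d x<y no-cover = search y (<[]-wellFounded d y) x<y (inj₁ refl)
    where
    search : ∀ v → Acc _<[ d ]_ v → x <[ d ] v → v ≤[ d ] y → ⊥
    search v (acc below) x<v v≤y = no-cover (v , <∧¬between⇒⋖ d x<v no-middle , v≤y)
      where
      no-middle : ¬ (Σ[ z ∈ Fin n ] x <[ d ] z × z <[ d ] v)
      no-middle (z , x<z , z<v) = search z (below z<v) x<z (inj₂ (<[]-≤[]-trans d z<v v≤y))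

  Step : Rel (Fin n) 0ℓ
  Step x y = Σ Dir (x ⋖[_] y)

  Walk : Rel (Fin n) 0ℓ
  Walk = Star Step

  toStep : HasseU _≺_ x y → Step x y
  toStep (inj₁ c) = up , c
  toStep (inj₂ c) = down , c

  toHasse : Step x y → HasseU _≺_ x y
  toHasse (up   , c) = inj₁ c
  toHasse (down , c) = inj₂ c

  length : Walk x y → ℕ
  length ε       = 0
  length (_ ◅ p) = suc (length p)

  vertices : (p : Walk x y) → Vec (Fin n) (suc (length p))
  vertices {x} ε       = x ∷ []
  vertices {x} (_ ◅ p) = x ∷ vertices p

  NonBacktracking : Walk x y → Set
  NonBacktracking ε                         = ⊤
  NonBacktracking (_ ◅ ε)                   = ⊤
  NonBacktracking {x} (_ ◅ _◅_ {j = z} s p) = x ≢ z × NonBacktracking (s ◅ p)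

  Has : Dir → Walk x y → Set
  Has d ε              = ⊥
  Has d ((d′ , _) ◅ p) = d ≡ d′ ⊎ Has d p

  Monotone : Dir → Walk x y → Set
  Monotone d p = ¬ Has (opp d) p

  nonBacktracking-tail : (s : Step x y) (p : Walk y z) → NonBacktracking (s ◅ p) → NonBacktracking p
  nonBacktracking-tail s ε       _        = tt
  nonBacktracking-tail s (_ ◅ _) (_ , nb) = nb

  nonBacktracking-prefix : (p : Walk x y) (q : Walk y z) → NonBacktracking (p ◅◅ q) → NonBacktracking p
  nonBacktracking-prefix ε           q _         = tt
  nonBacktracking-prefix (s ◅ ε)     q _         = tt
  nonBacktracking-prefix (s ◅ t ◅ p) q (x≢ , nb) = x≢ , nonBacktracking-prefix (t ◅ p) q nb

  Has-◅◅ʳ : ∀ {d} (p : Walk x y) {q : Walk y z} → Has d q → Has d (p ◅◅ q)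
  Has-◅◅ʳ ε       h = h
  Has-◅◅ʳ (_ ◅ p) h = inj₂ (Has-◅◅ʳ p h)

  lookup-vertices-last : (p : Walk x y) → lookup (vertices p) (fromℕ (length p)) ≡ y
  lookup-vertices-last ε       = refl
  lookup-vertices-last (_ ◅ p) = lookup-vertices-last p

  lookup-vertices-step : (p : Walk x y) (i : Fin (length p)) →
                         HasseU _≺_ (lookup (vertices p) (inject₁ i)) (lookup (vertices p) (fsuc i))
  lookup-vertices-step (s ◅ ε)     fzero    = toHasse s
  lookup-vertices-step (s ◅ _ ◅ _) fzero    = toHasse s
  lookup-vertices-step (_ ◅ p)     (fsuc i) = lookup-vertices-step p i

  All-vertices-prefix : ∀ {P : Pred (Fin n) 0ℓ} (p : Walk x y) (q : Walk y z) →
                        All P (vertices (p ◅◅ q)) → All P (vertices p)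
  All-vertices-prefix ε       ε       (py ∷ _)  = py ∷ []
  All-vertices-prefix ε       (_ ◅ _) (py ∷ _)  = py ∷ []
  All-vertices-prefix (_ ◅ p) q       (px ∷ ps) = px ∷ All-vertices-prefix p q ps

  Unique-vertices-prefix : (p : Walk x y) (q : Walk y z) → Unique (vertices (p ◅◅ q)) → Unique (vertices p)
  Unique-vertices-prefix ε       q _           = [] ∷ []
  Unique-vertices-prefix (_ ◅ p) q (x∉ ∷ uniq) = All-vertices-prefix p q x∉ ∷ Unique-vertices-prefix p q uniq

  split-at : ∀ z (p : Walk x y) → All (z ≢_) (vertices p) ⊎ (Σ[ q ∈ Walk x z ] Σ[ r ∈ Walk z y ] p ≡ q ◅◅ r)
  split-at {x} z p with z ≟ x
  split-at z ε       | no z≢x = inj₁ (z≢x ∷ [])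
  split-at z (s ◅ p) | no z≢x with split-at z p
  ... | inj₁ z∉p            = inj₁ (z≢x ∷ z∉p)
  ... | inj₂ (q , r , refl) = inj₂ (s ◅ q , r , refl)
  split-at z p       | yes refl = inj₂ (ε , p , refl)

  closed-walk⇒Cycle : (s : Step x y) (q : Walk y x) (r : Walk x z) →
                      NonBacktracking (s ◅ q ◅◅ r) → Unique (vertices q) → Cycle (HasseU _≺_)
  closed-walk⇒Cycle (d , c) ε              r _         _    = ⊥-elim (<[]-irrefl d (⋖⇒< d c))
  closed-walk⇒Cycle s       (_ ◅ ε)        r (x≢x , _) _    = ⊥-elim (x≢x refl)
  closed-walk⇒Cycle s       q@(_ ◅ _ ◅ q′) r _         uniq = record
    { len   = length q′
    ; vert  = lookup (vertices q)
    ; inj   = lookup-injective uniq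
    ; step  = lookup-vertices-step q
    ; close = subst (λ v → HasseU _≺_ v _) (≡-sym (lookup-vertices-last q)) (toHasse s)
    }

  Unique-vertices⊎Cycle : (p : Walk x y) → NonBacktracking p → Unique (vertices p) ⊎ Cycle (HasseU _≺_)
  Unique-vertices⊎Cycle ε _ = inj₁ ([] ∷ [])
  Unique-vertices⊎Cycle {x} (s ◅ p) nb with Unique-vertices⊎Cycle p (nonBacktracking-tail s p nb)
  ... | inj₂ cycle = inj₂ cycle
  ... | inj₁ uniq with split-at x p
  ...   | inj₁ x∉p            = inj₁ (x∉p ∷ uniq)
  ...   | inj₂ (q , r , refl) = inj₂ (closed-walk⇒Cycle s q r nb (Unique-vertices-prefix q r uniq))

  closed-walk-backtracks : (s : Step x y) (p : Walk y x) → ¬ NonBacktracking (s ◅ p)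
  closed-walk-backtracks s p nb with Unique-vertices⊎Cycle (s ◅ p) nb
  ... | inj₂ cycle     = proj₂ hasse-tree cycle
  ... | inj₁ (x∉p ∷ _) = lookup⁺ x∉p (fromℕ (length p)) (≡-sym (lookup-vertices-last p))

  -- Induction on x towards y. If the walk does not leave x along a cover x ⋖ w towards y, prepending
  -- the reverse of that cover gives a turning non-backtracking walk from w, which is closer to y.
  -- Once x = y, a nonempty non-backtracking closed walk would contain a cycle.
  ≤[]⇒monotone : ∀ d → x ≤[ d ] y → (p : Walk x y) → NonBacktracking p → Monotone d p
  ≤[]⇒monotone {x} {y} d = go x (>[]-wellFounded d x)
    where
    go : ∀ x → Acc (flip _<[ d ]_) x → x ≤[ d ] y → (p : Walk x y) → NonBacktracking p → Monotone d p
    go x _ _ ε _ ()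
    go x _ (inj₁ refl) (s ◅ p) nb _ = closed-walk-backtracks s p nb
    go x (acc above) (inj₂ x<y) (_◅_ {j = u} (d′ , c) p) nb turn = cover-towards d x<y first-cover
      where
      first-cover : ¬ (Σ[ w ∈ Fin n ] x ⋖[ d ] w × w ≤[ d ] y)
      first-cover (w , x⋖w , w≤y) with u ≟ w | Dir-cases d d′
      ... | no u≢w | _ = go w (above (⋖⇒< d x⋖w)) w≤y ((opp d , ⋖-opp d x⋖w) ◅ (d′ , c) ◅ p)
                            (u≢w ∘ ≡-sym , nb) (inj₁ refl)
      ... | yes refl | inj₁ refl = go u (above (⋖⇒< d x⋖w)) w≤y p (nonBacktracking-tail _ p nb)
                                     ([ ⊥-elim ∘ opp≢ d , id ] turn)
      ... | yes refl | inj₂ refl = <[]-asym d (⋖⇒< d x⋖w) (<[opp]⇒> d (⋖⇒< (opp d) c))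

  monotone⇒≤[] : ∀ d (p : Walk x y) → Monotone d p → x ≤[ d ] y
  monotone⇒≤[] d ε _ = inj₁ refl
  monotone⇒≤[] d ((d′ , c) ◅ p) mono with Dir-cases d d′
  ... | inj₁ refl = inj₂ (<[]-≤[]-trans d (⋖⇒< d c) (monotone⇒≤[] d p (mono ∘ inj₂)))
  ... | inj₂ refl = ⊥-elim (mono (inj₁ refl))

  data Course (d : Dir) {x : Fin n} : ∀ {y} → Walk x y → Set where
    straight : ∀ {y} {p : Walk x y} → Monotone d p → Course d p
    turns    : ∀ {t s y} (A : Walk x t) → Monotone d A → (c : t ⋖[ opp d ] s) (rest : Walk s y) →
               Course d (A ◅◅ (opp d , c) ◅ rest)

  course : ∀ d (p : Walk x y) → Course d p
  course d ε = straight λ ()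
  course d ((d′ , c) ◅ p) with Dir-cases d d′
  ... | inj₂ refl = turns ε (λ ()) c p
  ... | inj₁ refl with course d p
  ...   | straight mono         = straight [ opp≢ d , mono ]
  ...   | turns A mono c′ rest  = turns ((d , c) ◅ A) [ opp≢ d , mono ] c′ rest

  walk-through : ∀ m (f : Fin (suc m) → Fin n) → (∀ i → HasseU _≺_ (f (inject₁ i)) (f (fsuc i))) →
                 Walk (f fzero) (f (fromℕ m))
  walk-through zero    f steps = ε
  walk-through (suc m) f steps = toStep (steps fzero) ◅ walk-through m (f ∘ fsuc) (steps ∘ fsuc)

  walk-through-nonBacktracking : ∀ m f steps → (∀ {i j} → f i ≡ f j → i ≡ j) →
                                 NonBacktracking (walk-through m f steps)
  walk-through-nonBacktracking zero          f steps f-inj = tt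
  walk-through-nonBacktracking (suc zero)    f steps f-inj = tt
  walk-through-nonBacktracking (suc (suc m)) f steps f-inj =
    (λ f0≡f2 → 0≢2 (f-inj f0≡f2)) ,
    walk-through-nonBacktracking (suc m) (f ∘ fsuc) (steps ∘ fsuc) (suc-injective ∘ f-inj)
    where
    0≢2 : fzero ≢ fsuc (fsuc {suc m} fzero)
    0≢2 ()

  tree-walk : ∀ x y → Σ (Walk x y) NonBacktracking
  tree-walk x y = subst₂ (λ a b → Σ (Walk a b) NonBacktracking) start end
    (walk-through len vert step , walk-through-nonBacktracking len vert step (inj _ _))
    where open Path (proj₁ hasse-tree x y)

  _≺?_ : Decidable _≺_
  x ≺? y with tree-walk x y
  ... | p , nb with course up p
  ...   | turns A _ c rest = no λ x≺y → ≤[]⇒monotone up (inj₂ x≺y) p nb (Has-◅◅ʳ A (inj₁ refl))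
  ...   | straight mono with monotone⇒≤[] up p mono
  ...     | inj₁ refl = no ≺-irrefl
  ...     | inj₂ x≺y  = yes x≺y

module TreelikeGraph {n : ℕ} (G : Graph (Fin n)) (_≺_ : Rel (Fin n) 0ℓ)
                     (treelike : TreelikeOrientation G _≺_) where

  open IsTransitiveOrientation (proj₁ treelike) renaming (asym to ≺-asym; trans to ≺-trans)
  open HasseTree _≺_ ≺-asym ≺-trans (proj₂ treelike)

  private
    variable
      x y : Fin n

  <[]⇒Adj : ∀ d → x <[ d ] y → Adj G x y
  <[]⇒Adj up   = arc→edge
  <[]⇒Adj down = sym G ∘ arc→edge

  ⋖[]⇒Adj : ∀ d → x ⋖[ d ] y → Adj G x y
  ⋖[]⇒Adj d = <[]⇒Adj d ∘ ⋖⇒< d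

  Adj⇒<[]⊎>[] : ∀ d → Adj G x y → x <[ d ] y ⊎ y <[ d ] x
  Adj⇒<[]⊎>[] up   = edge→arc
  Adj⇒<[]⊎>[] down = swap ∘ edge→arc

  Adj? : Decidable (Adj G)
  Adj? x y = map′ [ arc→edge , sym G ∘ arc→edge ] edge→arc (x ≺? y ⊎-dec y ≺? x)

  InducedP4? : Dec (InducedP4 G)
  InducedP4? = any? λ a → any? λ b → any? λ c → any? λ d →
    Adj? a b ×-dec Adj? b c ×-dec Adj? c d ×-dec ¬? (Adj? a c) ×-dec ¬? (Adj? b d) ×-dec ¬? (Adj? a d)

  turning⇒¬Adj : ∀ d (p : Walk x y) → NonBacktracking p → Has d p → Has (opp d) p → ¬ Adj G x y
  turning⇒¬Adj d p nb has has-opp adj with Adj⇒<[]⊎>[] d adj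
  ... | inj₁ x<y = ≤[]⇒monotone d (inj₂ x<y) p nb has-opp
  ... | inj₂ y<x = ≤[]⇒monotone (opp d) (inj₂ (>⇒<[opp] d y<x)) p nb
                     (subst (λ e → Has e p) (≡-sym (opp-involutive d)) has)

  turn⇒InducedP4 : ∀ d {u u₁ z₁ t s w} → u ⋖[ d ] z₁ → z₁ ≢ u₁ →
                   (c₀ : u ⋖[ d ] u₁) (A : Walk u₁ t) → Monotone d A → (c : t ⋖[ opp d ] s) (rest : Walk s w) →
                   NonBacktracking ((d , c₀) ◅ A ◅◅ (opp d , c) ◅ rest) → InducedP4 G
  turn⇒InducedP4 d {u} {u₁} {z₁} {t} {s} c₁ z₁≢u₁ c₀ A mono c rest nb =
    z₁ , u , t , s ,
    sym G (⋖[]⇒Adj d c₁) ,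
    <[]⇒Adj d (<[]-≤[]-trans d (⋖⇒< d c₀) (monotone⇒≤[] d A mono)) ,
    ⋖[]⇒Adj (opp d) c ,
    turning⇒¬Adj d (back ◅ (d , c₀) ◅ A) (nonBacktracking-prefix (back ◅ (d , c₀) ◅ A) _ W-nb)
      (inj₂ (inj₁ refl)) (inj₁ refl) ,
    turning⇒¬Adj d ((d , c₀) ◅ A ◅◅ (opp d , c) ◅ ε) (nonBacktracking-tail back _ W-nb)
      (inj₁ refl) (inj₂ (Has-◅◅ʳ A (inj₁ refl))) ,
    turning⇒¬Adj d W W-nb (inj₂ (inj₁ refl)) (inj₁ refl)
    where
    back : Step z₁ u
    back = opp d , ⋖-opp d c₁

    W : Walk z₁ s
    W = back ◅ (d , c₀) ◅ A ◅◅ (opp d , c) ◅ ε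

    W-nb : NonBacktracking W
    W-nb = z₁≢u₁ , nonBacktracking-prefix ((d , c₀) ◅ A ◅◅ (opp d , c) ◅ ε) rest
      (subst NonBacktracking (cong ((d , c₀) ◅_) (≡-sym (◅◅-assoc A ((opp d , c) ◅ ε) rest))) nb)

  ClosedNbhd : Fin n → Pred (Fin n) 0ℓ
  ClosedNbhd u z = z ≡ u ⊎ Adj G u z

  ClosedNbhd? : ∀ u → Decidable₁ (ClosedNbhd u)
  ClosedNbhd? u z = z ≟ u ⊎-dec Adj? u z

  ≤[]⇒ClosedNbhd : ∀ d → x ≤[ d ] y → ClosedNbhd x y
  ≤[]⇒ClosedNbhd d (inj₁ refl) = inj₁ refl
  ≤[]⇒ClosedNbhd d (inj₂ x<y)  = inj₂ (<[]⇒Adj d x<y)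

  unique-cover⇒ClosedNbhd-mono : ∀ d {u u₁} → u ⋖[ d ] u₁ → (∀ {z₁} → u ⋖[ d ] z₁ → z₁ ≡ u₁) →
                                 ∀ {z} → ClosedNbhd u z → ClosedNbhd u₁ z
  unique-cover⇒ClosedNbhd-mono d c₀ unique (inj₁ refl) = inj₂ (sym G (⋖[]⇒Adj d c₀))
  unique-cover⇒ClosedNbhd-mono d {u} {u₁} c₀ unique {z} (inj₂ adj) with Adj⇒<[]⊎>[] d adj
  ... | inj₂ z<u = inj₂ (sym G (<[]⇒Adj d (<[]-trans d z<u (⋖⇒< d c₀))))
  ... | inj₁ u<z = decidable-stable (ClosedNbhd? u₁ z) λ z∉N[u₁] →
    cover-towards d u<z λ (z₁ , c₁ , z₁≤z) →
      z∉N[u₁] (≤[]⇒ClosedNbhd d (subst (_≤[ d ] z) (unique c₁) z₁≤z))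

  N[_] : Fin n → Subset n
  N[ u ] = subset (ClosedNbhd? u)

  module P4-free (no-P4 : ¬ InducedP4 G) where

    Maximal : Fin n → Set
    Maximal u = ∀ v → ∣ N[ v ] ∣ ≤ ∣ N[ u ] ∣

    reaches⊎grows : ∀ d {u u₁ w} (c₀ : u ⋖[ d ] u₁) (q : Walk u₁ w) → NonBacktracking ((d , c₀) ◅ q) →
                    w ∈ N[ u ] ⊎ N[ u ] ⊆ N[ u₁ ]
    reaches⊎grows d c₀ q nb with course d q
    ... | straight mono = inj₁ (∈-subset⁺ (ClosedNbhd? _)
      (≤[]⇒ClosedNbhd d (inj₂ (<[]-≤[]-trans d (⋖⇒< d c₀) (monotone⇒≤[] d q mono)))))
    ... | turns A mono c rest = inj₂ (subset-mono (ClosedNbhd? _) (ClosedNbhd? _)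
      (unique-cover⇒ClosedNbhd-mono d c₀ λ c₁ → decidable-stable (_ ≟ _) λ z₁≢u₁ →
        no-P4 (turn⇒InducedP4 d c₁ z₁≢u₁ c₀ A mono c rest nb)))

    maximal-reaches : ∀ {u w} → Maximal u → (q : Walk u w) → NonBacktracking q → w ∈ N[ u ]
    maximal-reaches max ε _ = ∈-subset⁺ (ClosedNbhd? _) (inj₁ refl)
    maximal-reaches max ((d , c₀) ◅ q) nb with reaches⊎grows d c₀ q nb
    ... | inj₁ w∈N[u]     = w∈N[u]
    ... | inj₂ N[u]⊆N[u₁] =
      p⊆q∧∣q∣≤∣p∣⇒q⊆p N[u]⊆N[u₁] (max _)
        (maximal-reaches (λ v → ≤-trans (max v) (p⊆q⇒∣p∣≤∣q∣ N[u]⊆N[u₁])) q (nonBacktracking-tail _ q nb))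

    maximal⇒universal : ∀ {r} → Maximal r → ∀ v → v ≢ r → Adj G r v
    maximal⇒universal {r} r-maximal v v≢r =
      let (p , nb) = tree-walk r v
      in [ ⊥-elim ∘ v≢r , id ] (∈-subset⁻ (ClosedNbhd? r) (maximal-reaches r-maximal p nb))

    universal-vertex : Fin n → Σ[ r ∈ Fin n ] ∀ v → v ≢ r → Adj G r v
    universal-vertex v₀ = argmax size v₀ (allFin n) , maximal⇒universal argmax-maximal
      where
      size : Fin n → ℕ
      size v = ∣ N[ v ] ∣

      argmax-maximal : Maximal (argmax size v₀ (allFin n))
      argmax-maximal v = ListAll.lookup (f[xs]≤f[argmax] {f = size} v₀ (allFin n)) (∈-allFin v)

lemma2 : ∀ {n : ℕ} (G : Graph (Fin n)) → Connected (Adj G) →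
         (k : ℕ) → 2 ≤ k → PathOfDAs G k →
         (∀ (j : ℕ) → j < k → ¬ PathOfDAs G j) →
         InducedP4 G
lemma2 G _ k 2≤k P minimal = decidable-stable InducedP4? λ no-P4 →
  let (r , universal) = P4-free.universal-vertex no-P4 (path fzero)
  in minimal 1 2≤k (universal⇒PathOfDAs₁ treelike r universal)
  where
  open PathOfDAs P
  open TreelikeGraph G _≺_ treelike
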